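{- Let $g_i:\{ -1,1\}^{n_i}\to\{ -1,1\}$ ($i=1,\dots,k$), $f:\{ -1,1\}^k\to\{ -1,1\}$, and $h(x^1,\dots,x^k)=f(g_1(x^1),\dots,g_k(x^k))$ on disjoint blocks of variables, with the domain of $h$ endowed with a product distribution $\mu$. Let $\eta=\langle\mathbb{E}_\mu[g_1],\dots,\mathbb{E}_\mu[g_k]\rangle$. Let $\mathcal{Y}\sim\widetilde h^2\setminus\emptyset$ (under $\mu$), let $\mathcal{Y}_i$ be the restriction of $\mathcal{Y}$ to the coordinates of block $x^i$, and let $S=\{i\in[k]:\mathcal{Y}_i\ne\emptyset\}$. Then $S$ is distributed as $\widetilde f^2\setminus\emptyset$, where $\widetilde f$ is the $\eta$-biased Fourier transform of $f$.
   Context: For a product distribution with biases $\mu_j=\mathbb{E}[x_j]$, $|\mu_j|<1$, the biased Fourier coefficients of $F$ are $\widetilde F(S)=\mathbb{E}[F\phi_S]$ with $\phi_S(x)=\prod_{j\in S}(x_j-\mu_j)/\sqrt{1-\mu_j^2}$. For Boolean $F$ with positive variance, $\widetilde F^2\setminus\emptyset$ is the distribution on nonempty sets $S$ with probability $\widetilde F(S)^2/(1-\widetilde F(\emptyset)^2)$. The functions are assumed nonconstant under the relevant distributions (in particular $|\eta_i|<1$) so these are defined. -}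

module Defs where

open import Data.Bool using (Bool; true; false; if_then_else_; _∨_; _∧_)
open import Data.Nat using (ℕ; zero; suc) renaming (_+_ to _+ℕ_)
open import Data.Fin using (Fin; zero; suc)
open import Data.Vec using (Vec; []; _∷_; take; drop; _++_; tabulate; replicate; foldr; zipWith)
open import Data.List using (List; []; _∷_; concatMap) renaming (map to mapL; foldr to foldrL)
open import Data.Sum using (_⊎_)
open import Data.Product using (_×_; ∃; _,_)
open import Relation.Binary.PropositionalEquality using (_≡_; _≢_)
open import Data.Empty using (⊥)
open import Algebra.Structures using (IsCommutativeRing)

-- The real numbers, axiomatised as a complete ordered field
-- (any two such are isomorphic to ℝ).
-- A square-root operation on non-negatives is included as data
-- (it exists and is unique in any complete ordered field).

record RealField : Set₁ where
  infixl 7 _*_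
  infixl 6 _+_
  infix  4 _<_
  infix  8 -_
  infix  9 _⁻¹
  field
    Carrier : Set
    _+_ _*_ : Carrier → Carrier → Carrier
    -_      : Carrier → Carrier
    0# 1#   : Carrier
    _⁻¹     : Carrier → Carrier
    _<_     : Carrier → Carrier → Set
    √       : Carrier → Carrier
    isCommutativeRing : IsCommutativeRing _≡_ _+_ _*_ -_ 0# 1#
    0≢1       : 0# ≢ 1#
    ⁻¹-inverse : ∀ x → x ≢ 0# → x * (x ⁻¹) ≡ 1#
    <-irrefl  : ∀ x → x < x → ⊥
    <-trans   : ∀ {x y z} → x < y → y < z → x < z
    <-trichotomy : ∀ x y → x < y ⊎ (x ≡ y ⊎ y < x)
    +-mono-<  : ∀ {x y} z → x < y → x + z < y + z
    *-pos     : ∀ {x y} → 0# < x → 0# < y → 0# < x * y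
    √-nonneg  : ∀ x → (0# < x ⊎ 0# ≡ x) → (0# < √ x ⊎ 0# ≡ √ x)
    √-square  : ∀ x → (0# < x ⊎ 0# ≡ x) → √ x * √ x ≡ x
    lub : (P : Carrier → Set) → ∃ P →
          ∃ (λ b → ∀ x → P x → (x < b ⊎ x ≡ b)) →
          ∃ (λ s → (∀ x → P x → (x < s ⊎ x ≡ s)) ×
                   (∀ b → (∀ x → P x → (x < b ⊎ x ≡ b)) → (s < b ⊎ s ≡ b)))

-- Biased Fourier analysis on {-1,1}^m (points and subsets of [m] are
-- both Vec Bool m; true ↦ +1, false ↦ -1; for subsets true = member).

nonempty : ∀ {m} → Vec Bool m → Bool
nonempty = foldr _ _∨_ false

module Fourier (R : RealField) where
  open RealField R

  infixl 6 _-_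
  infix 9 _²
  _-_ : Carrier → Carrier → Carrier
  x - y = x + (- y)

  _² : Carrier → Carrier
  x ² = x * x

  2# : Carrier
  2# = 1# + 1#

  ± : Bool → Carrier
  ± true  = 1#
  ± false = - 1#

  cube : (m : ℕ) → List (Vec Bool m)
  cube zero    = [] ∷ []
  cube (suc m) = concatMap (λ xs → (true ∷ xs) ∷ (false ∷ xs) ∷ []) (cube m)

  sumL : List Carrier → Carrier
  sumL = foldrL _+_ 0#

  prodV : ∀ {m} → Vec Carrier m → Carrier
  prodV = foldr _ _*_ 1#

  prob : ∀ {m} → Vec Carrier m → Vec Bool m → Carrier
  prob μ x = prodV (zipWith (λ μj xj → (1# + μj * ± xj) * (2# ⁻¹)) μ x)

  E : ∀ {m} → Vec Carrier m → (Vec Bool m → Carrier) → Carrier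
  E {m} μ F = sumL (mapL (λ x → prob μ x * F x) (cube m))

  φ : ∀ {m} → Vec Carrier m → Vec Bool m → Vec Bool m → Carrier
  φ μ S x = prodV (zipWith (λ μj (sj , xj) →
                      if sj then (± xj - μj) * (√ (1# - μj ²)) ⁻¹ else 1#)
                    μ (zipWith _,_ S x))

  coeff : ∀ {m} → Vec Carrier m → (Vec Bool m → Bool) → Vec Bool m → Carrier
  coeff μ F S = E μ (λ x → ± (F x) * φ μ S x)

  Var : ∀ {m} → Vec Carrier m → (Vec Bool m → Bool) → Carrier
  Var μ F = E μ (λ x → ± (F x) ²) - (E μ (λ x → ± (F x))) ²

  ∅ : ∀ {m} → Vec Bool m
  ∅ = replicate _ false

  -- the distribution  F̃² ∖ ∅  as a probability mass function on subsets
  -- (mass 0 on ∅)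
  massNE : ∀ {m} → Vec Carrier m → (Vec Bool m → Bool) → Vec Bool m → Carrier
  massNE μ F S =
    if nonempty S then coeff μ F S ² * (1# - coeff μ F ∅ ²) ⁻¹ else 0#

  eqᵇ : ∀ {m} → Vec Bool m → Vec Bool m → Bool
  eqᵇ []       []       = true
  eqᵇ (a ∷ as) (b ∷ bs) = (if a then b else (if b then false else true)) ∧ eqᵇ as bs

  ⟦_⟧ : Bool → Carrier
  ⟦ true ⟧  = 1#
  ⟦ false ⟧ = 0#

-- Disjoint blocks of variables x¹,…,xᵏ, xⁱ ∈ {-1,1}^{n i}, laid out
-- consecutively in one vector of length total k n.

total : (k : ℕ) → (Fin k → ℕ) → ℕ
total zero    n = zero
total (suc k) n = n zero +ℕ total k (λ i → n (suc i))

concatBlocks : ∀ {A : Set} (k : ℕ) (n : Fin k → ℕ) →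
               ((i : Fin k) → Vec A (n i)) → Vec A (total k n)
concatBlocks zero    n xs = []
concatBlocks (suc k) n xs = xs zero ++ concatBlocks k (λ i → n (suc i)) (λ i → xs (suc i))

block : ∀ {A : Set} (k : ℕ) (n : Fin k → ℕ) → Vec A (total k n) → (i : Fin k) → Vec A (n i)
block (suc k) n xs zero    = take (n zero) xs
block (suc k) n xs (suc i) = block k (λ j → n (suc j)) (drop (n zero) xs) i

compose : (k : ℕ) (n : Fin k → ℕ) → ((i : Fin k) → Vec Bool (n i) → Bool) →
          (Vec Bool k → Bool) → Vec Bool (total k n) → Bool
compose k n g f x = f (tabulate (λ i → g i (block k n x i)))

blockPattern : (k : ℕ) (n : Fin k → ℕ) → Vec Bool (total k n) → Vec Bool k
blockPattern k n Y = tabulate (λ i → nonempty (block k n Y i))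

module Submission where

-- The proof computes the coefficients of h exactly.  Every function of one bit of
-- mean e expands in the orthonormal basis {1, (x - e)/√(1 - e²)}; expanding f in
-- each of its arguments and separating independent blocks gives
--   h̃(Y) = f̃(S(Y)) · Π_i w_i(Y ∩ block i),   w_i(∅) = 1,  w_i(Y_i) = g̃_i(Y_i)/√(1 - η_i²),
-- and by Parseval for g_i the squared weights of the nonempty subsets of a block sum
-- to 1.  Summing h̃(Y)² over all Y with S(Y) = T therefore gives f̃(T)², and
-- h̃(∅) = f̃(∅) makes the normalisations agree.

open import Defs
open import Data.Bool using (Bool)
open import Data.Nat using (ℕ)
open import Data.Fin using (Fin)
open import Data.Vec using (Vec; lookup; tabulate)
open import Data.List using (map)
open import Data.Product using (_×_)
open import Relation.Binary.PropositionalEquality using (_≡_)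

open import Algebra.Bundles using (CommutativeRing)
open import Algebra.Structures using (IsCommutativeRing)
import Algebra.Solver.Ring.AlmostCommutativeRing as ACR
open import Data.Bool using (true; false; if_then_else_; not; _∧_; _∨_)
open import Data.Bool.Properties using (∨-assoc; ∨-conicalˡ; ∨-conicalʳ)
open import Data.Empty using (⊥-elim)
open import Data.Fin using (zero; suc)
open import Data.Integer as ℤ using (ℤ; -[1+_]; _⊖_)
import Data.Integer.Properties as ℤ
open import Data.List using (List; []; _∷_; concatMap) renaming (map to mapL)
open import Data.Maybe using (Maybe; just; nothing)
open import Data.Nat using (zero; suc)
import Data.Nat as ℕ
import Data.Nat.Properties as ℕ
open import Data.Product using (_,_)
open import Data.Sign as Sign using ()
open import Data.Sum using (inj₁; inj₂)
open import Data.Vec using ([]; _∷_; _++_; take; drop)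
open import Data.Vec.Properties using (take++drop≡id)
open import Data.Vec.Relation.Unary.All using (All; []; _∷_)
open import Data.Vec.Relation.Unary.All.Properties using (lookup⁻)
open import Relation.Binary.PropositionalEquality
  using (refl; sym; trans; cong; cong₂; subst; subst₂; _≢_; module ≡-Reasoning)
open import Relation.Nullary using (yes; no)

-- The standard library's ring solver for any commutative ring whose equality is
-- propositional, with integer coefficients interpreted through the canonical ring
-- map ℤ → A.
module RingSolver {A : Set} {_+ᴬ_ _*ᴬ_ : A → A → A} { -ᴬ_ : A → A } {0ᴬ 1ᴬ : A}
                  (isCommutativeRing : IsCommutativeRing _≡_ _+ᴬ_ _*ᴬ_ -ᴬ_ 0ᴬ 1ᴬ) where
  open ≡-Reasoning

  commutativeRing : CommutativeRing _ _
  commutativeRing = record { isCommutativeRing = isCommutativeRing }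

  open CommutativeRing commutativeRing
    using (_+_; _*_; -_; 0#; 1#; ring; semiring; +-assoc; +-comm; +-identityˡ; +-identityʳ; -‿inverseʳ)
  open import Algebra.Properties.Ring ring using (-0#≈0#; -‿involutive; -‿+-comm; -‿distribˡ-*; -‿distribʳ-*)
  open import Algebra.Properties.Semiring.Mult.TCOptimised semiring using (×-homo-+; ×1-homo-*) renaming (_×_ to _·_)

  ι : ℕ → A
  ι n = n · 1#

  ⟦_⟧ℤ : ℤ → A
  ⟦ ℤ.+ n ⟧ℤ   = ι n
  ⟦ -[1+ n ] ⟧ℤ = - ι (ℕ.suc n)

  -‿homo : ∀ i → ⟦ ℤ.- i ⟧ℤ ≡ - ⟦ i ⟧ℤ
  -‿homo (ℤ.+ ℕ.zero)  = sym -0#≈0#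
  -‿homo (ℤ.+ ℕ.suc n) = refl
  -‿homo -[1+ n ]      = sym (-‿involutive _)

  +-cancel-− : ∀ a x y → (a + x) + - (a + y) ≡ x + - y
  +-cancel-− a x y = begin
    (a + x) + - (a + y)      ≡⟨ cong ((a + x) +_) (sym (-‿+-comm a y)) ⟩
    (a + x) + (- a + - y)    ≡⟨ cong (_+ (- a + - y)) (+-comm a x) ⟩
    (x + a) + (- a + - y)    ≡⟨ +-assoc x a _ ⟩
    x + (a + (- a + - y))    ≡⟨ cong (x +_) (sym (+-assoc a (- a) (- y))) ⟩
    x + ((a + - a) + - y)    ≡⟨ cong (λ z → x + (z + - y)) (-‿inverseʳ a) ⟩
    x + (0# + - y)           ≡⟨ cong (x +_) (+-identityˡ (- y)) ⟩
    x + - y                  ∎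

  ⊖-homo : ∀ m n → ⟦ m ⊖ n ⟧ℤ ≡ ι m + - ι n
  ⊖-homo ℕ.zero    ℕ.zero    = sym (trans (+-identityˡ _) -0#≈0#)
  ⊖-homo ℕ.zero    (ℕ.suc n) = sym (+-identityˡ _)
  ⊖-homo (ℕ.suc m) ℕ.zero    = sym (trans (cong (ι (ℕ.suc m) +_) -0#≈0#) (+-identityʳ _))
  ⊖-homo (ℕ.suc m) (ℕ.suc n) = begin
    ⟦ ℕ.suc m ⊖ ℕ.suc n ⟧ℤ        ≡⟨ cong ⟦_⟧ℤ (ℤ.[1+m]⊖[1+n]≡m⊖n m n) ⟩
    ⟦ m ⊖ n ⟧ℤ                    ≡⟨ ⊖-homo m n ⟩
    ι m + - ι n                   ≡⟨ sym (+-cancel-− 1# (ι m) (ι n)) ⟩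
    (1# + ι m) + - (1# + ι n)     ≡⟨ sym (cong₂ (λ a b → a + - b) (×-homo-+ 1# 1 m) (×-homo-+ 1# 1 n)) ⟩
    ι (ℕ.suc m) + - ι (ℕ.suc n)   ∎

  +-homo : ∀ i j → ⟦ i ℤ.+ j ⟧ℤ ≡ ⟦ i ⟧ℤ + ⟦ j ⟧ℤ
  +-homo (ℤ.+ m)  (ℤ.+ n)  = ×-homo-+ 1# m n
  +-homo (ℤ.+ m)  -[1+ n ] = ⊖-homo m (ℕ.suc n)
  +-homo -[1+ m ] (ℤ.+ n)  = trans (⊖-homo n (ℕ.suc m)) (+-comm _ _)
  +-homo -[1+ m ] -[1+ n ] = begin
    - ι (ℕ.suc (ℕ.suc (m ℕ.+ n)))      ≡⟨ cong (λ k → - ι k) (sym (ℕ.+-suc (ℕ.suc m) n)) ⟩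
    - ι (ℕ.suc m ℕ.+ ℕ.suc n)          ≡⟨ cong -_ (×-homo-+ 1# (ℕ.suc m) (ℕ.suc n)) ⟩
    - (ι (ℕ.suc m) + ι (ℕ.suc n))      ≡⟨ sym (-‿+-comm _ _) ⟩
    - ι (ℕ.suc m) + - ι (ℕ.suc n)      ∎

  −ι-homo : ∀ k → ⟦ Sign.- ℤ.◃ k ⟧ℤ ≡ - ι k
  −ι-homo k = trans (cong ⟦_⟧ℤ (ℤ.-◃n≡-n k)) (-‿homo (ℤ.+ k))

  *-homo : ∀ i j → ⟦ i ℤ.* j ⟧ℤ ≡ ⟦ i ⟧ℤ * ⟦ j ⟧ℤ
  *-homo (ℤ.+ m)  (ℤ.+ n)  = trans (cong ⟦_⟧ℤ (ℤ.+◃n≡+n (m ℕ.* n))) (×1-homo-* m n)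
  *-homo (ℤ.+ m)  -[1+ n ] =
    trans (−ι-homo (m ℕ.* ℕ.suc n)) (trans (cong -_ (×1-homo-* m (ℕ.suc n))) (-‿distribʳ-* _ _))
  *-homo -[1+ m ] (ℤ.+ n)  =
    trans (−ι-homo (ℕ.suc m ℕ.* n)) (trans (cong -_ (×1-homo-* (ℕ.suc m) n)) (-‿distribˡ-* _ _))
  *-homo -[1+ m ] -[1+ n ] = begin
    ι (ℕ.suc m ℕ.* ℕ.suc n)          ≡⟨ ×1-homo-* (ℕ.suc m) (ℕ.suc n) ⟩
    a * b                            ≡⟨ sym (-‿involutive _) ⟩
    - - (a * b)                      ≡⟨ cong -_ (-‿distribˡ-* a b) ⟩
    - (- a * b)                      ≡⟨ -‿distribʳ-* (- a) b ⟩
    - a * - b                        ∎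
    where
    a = ι (ℕ.suc m)
    b = ι (ℕ.suc n)

  homomorphism : ℤ.+-*-rawRing ACR.-Raw-AlmostCommutative⟶ ACR.fromCommutativeRing commutativeRing
  homomorphism = record
    { ⟦_⟧ = ⟦_⟧ℤ ; +-homo = +-homo ; *-homo = *-homo ; -‿homo = -‿homo ; 0-homo = refl ; 1-homo = refl }

  ≟-homo : ∀ i j → Maybe (⟦ i ⟧ℤ ≡ ⟦ j ⟧ℤ)
  ≟-homo i j with i ℤ.≟ j
  ... | yes i≡j = just (cong ⟦_⟧ℤ i≡j)
  ... | no _    = nothing

  open import Algebra.Solver.Ring ℤ.+-*-rawRing (ACR.fromCommutativeRing commutativeRing) homomorphism ≟-homo public

module Development (R : RealField) where
  open RealField R
  open Fourier R
  open RingSolver isCommutativeRing using (commutativeRing; solve; _:=_; _:+_; _:*_; :-_; _:-_; con; Polynomial)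
  open CommutativeRing commutativeRing
    using (+-assoc; +-comm; *-assoc; *-comm; +-identityˡ; +-identityʳ; *-identityˡ; *-identityʳ;
           distribˡ; distribʳ; zeroˡ; zeroʳ; -‿inverseʳ)
  open ≡-Reasoning

  𝟘 𝟙 : ∀ {n} → Polynomial n
  𝟘 = con (ℤ.+ 0)
  𝟙 = con (ℤ.+ 1)

  cong₃ : ∀ (f : Carrier → Carrier → Carrier → Carrier) {x x′ y y′ z z′} →
          x ≡ x′ → y ≡ y′ → z ≡ z′ → f x y z ≡ f x′ y′ z′
  cong₃ f refl refl refl = refl

  -- Order facts.  0 < 1: otherwise 1 < 0, so 0 < -1 and 0 < (-1)(-1) = 1.
  0<1 : 0# < 1#
  0<1 with <-trichotomy 0# 1#
  ... | inj₁ 0<1         = 0<1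
  ... | inj₂ (inj₁ 0≡1)  = ⊥-elim (0≢1 0≡1)
  ... | inj₂ (inj₂ 1<0)  = ⊥-elim (<-irrefl 1# (<-trans 1<0 0<1′))
    where
    0<-1 : 0# < - 1#
    0<-1 = subst₂ _<_ (-‿inverseʳ 1#) (+-identityˡ (- 1#)) (+-mono-< (- 1#) 1<0)
    0<1′ : 0# < 1#
    0<1′ = subst (0# <_) (solve 0 (:- 𝟙 :* :- 𝟙 := 𝟙) refl) (*-pos 0<-1 0<-1)

  <⇒≢ : ∀ {x y} → x < y → y ≢ x
  <⇒≢ {x} x<y y≡x = <-irrefl x (subst (x <_) y≡x x<y)

  -- 2 is invertible, so the weights (1 ± e)/2 of a biased bit make sense
  2*½ : 2# * 2# ⁻¹ ≡ 1#
  2*½ = ⁻¹-inverse 2# (<⇒≢ 0<2)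
    where
    0<2 : 0# < 2#
    0<2 = <-trans 0<1 (subst (_< 2#) (+-identityˡ 1#) (+-mono-< 1# 0<1))

  -- ρ e = 1/√(1 - e²) normalises a ±1 bit of mean e to unit variance
  ρ : Carrier → Carrier
  ρ e = (√ (1# - e ²)) ⁻¹

  Nondegenerate : Carrier → Set
  Nondegenerate e = (1# - e ²) * (ρ e * ρ e) ≡ 1#

  nondegenerate : ∀ {e} → (- 1# < e) × (e < 1#) → Nondegenerate e
  nondegenerate {e} (-1<e , e<1) = begin
    (1# - e ²) * (s ⁻¹ * s ⁻¹)   ≡⟨ cong (_* (s ⁻¹ * s ⁻¹)) (sym s*s) ⟩
    (s * s) * (s ⁻¹ * s ⁻¹)     ≡⟨ solve 2 (λ s t → (s :* s) :* (t :* t) := (s :* t) :* (s :* t)) refl s (s ⁻¹) ⟩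
    (s * s ⁻¹) * (s * s ⁻¹)     ≡⟨ cong₂ _*_ s*s⁻¹ s*s⁻¹ ⟩
    1# * 1#                     ≡⟨ *-identityˡ 1# ⟩
    1#                          ∎
    where
    s = √ (1# - e ²)
    0<1+e : 0# < 1# + e
    0<1+e = subst₂ _<_ (solve 0 (:- 𝟙 :+ 𝟙 := 𝟘) refl) (+-comm e 1#) (+-mono-< 1# -1<e)
    0<1-e : 0# < 1# - e
    0<1-e = subst (_< 1# - e) (-‿inverseʳ e) (+-mono-< (- e) e<1)
    0<var : 0# < 1# - e ²
    0<var = subst (0# <_) (solve 1 (λ e → (𝟙 :+ e) :* (𝟙 :- e) := 𝟙 :- e :* e) refl e) (*-pos 0<1+e 0<1-e)
    s*s : s * s ≡ 1# - e ²
    s*s = √-square _ (inj₁ 0<var)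
    s*s⁻¹ : s * s ⁻¹ ≡ 1#
    s*s⁻¹ = ⁻¹-inverse s (λ s≡0 → <⇒≢ 0<var (trans (sym s*s) (trans (cong (λ x → x * x) s≡0) (zeroˡ 0#))))

  ∑ : {A : Set} → List A → (A → Carrier) → Carrier
  ∑ l F = sumL (mapL F l)

  ∑-cong : ∀ {A : Set} (l : List A) {F G : A → Carrier} → (∀ x → F x ≡ G x) → ∑ l F ≡ ∑ l G
  ∑-cong []      F≡G = refl
  ∑-cong (x ∷ l) F≡G = cong₂ _+_ (F≡G x) (∑-cong l F≡G)

  ∑-+ : ∀ {A : Set} (l : List A) (F G : A → Carrier) → ∑ l (λ x → F x + G x) ≡ ∑ l F + ∑ l G
  ∑-+ []      F G = solve 0 (𝟘 := 𝟘 :+ 𝟘) refl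
  ∑-+ (x ∷ l) F G = trans (cong (F x + G x +_) (∑-+ l F G))
    (solve 4 (λ a b c d → (a :+ b) :+ (c :+ d) := (a :+ c) :+ (b :+ d)) refl (F x) (G x) (∑ l F) (∑ l G))

  ∑-*ˡ : ∀ {A : Set} (l : List A) (c : Carrier) (F : A → Carrier) → ∑ l (λ x → c * F x) ≡ c * ∑ l F
  ∑-*ˡ []      c F = sym (zeroʳ c)
  ∑-*ˡ (x ∷ l) c F = trans (cong (c * F x +_) (∑-*ˡ l c F)) (sym (distribˡ c (F x) (∑ l F)))

  ∑-*ʳ : ∀ {A : Set} (l : List A) (c : Carrier) (F : A → Carrier) → ∑ l (λ x → F x * c) ≡ ∑ l F * c
  ∑-*ʳ l c F = trans (∑-cong l (λ x → *-comm (F x) c)) (trans (∑-*ˡ l c F) (*-comm c (∑ l F)))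

  Σcube : (m : ℕ) → (Vec Bool m → Carrier) → Carrier
  Σcube m = ∑ (cube m)

  Σcube-suc : ∀ m (F : Vec Bool (suc m) → Carrier) →
              Σcube (suc m) F ≡ Σcube m (λ x → F (true ∷ x) + F (false ∷ x))
  Σcube-suc m F = go (cube m)
    where
    go : (l : List (Vec Bool m)) →
         ∑ (concatMap (λ x → (true ∷ x) ∷ (false ∷ x) ∷ []) l) F ≡ ∑ l (λ x → F (true ∷ x) + F (false ∷ x))
    go []      = refl
    go (x ∷ l) = trans (sym (+-assoc _ _ _)) (cong (F (true ∷ x) + F (false ∷ x) +_) (go l))

  Σcube-++ : ∀ a b (F : Vec Bool (a ℕ.+ b) → Carrier) →
             Σcube (a ℕ.+ b) F ≡ Σcube a (λ x → Σcube b (λ y → F (x ++ y)))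
  Σcube-++ zero    b F = sym (+-identityʳ _)
  Σcube-++ (suc a) b F = begin
    Σcube (suc a ℕ.+ b) F
      ≡⟨ Σcube-suc (a ℕ.+ b) F ⟩
    Σcube (a ℕ.+ b) (λ z → F (true ∷ z) + F (false ∷ z))
      ≡⟨ Σcube-++ a b _ ⟩
    Σcube a (λ x → Σcube b (λ y → F (true ∷ x ++ y) + F (false ∷ x ++ y)))
      ≡⟨ ∑-cong (cube a) (λ x → ∑-+ (cube b) _ _) ⟩
    Σcube a (λ x → Σcube b (λ y → F (true ∷ x ++ y)) + Σcube b (λ y → F (false ∷ x ++ y)))
      ≡⟨ sym (Σcube-suc a _) ⟩
    Σcube (suc a) (λ x → Σcube b (λ y → F (x ++ y)))
      ∎

  Σcube-product : ∀ a b (u : Vec Bool a → Carrier) (v : Vec Bool b → Carrier) →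
                  Σcube a (λ x → Σcube b (λ y → u x * v y)) ≡ Σcube a u * Σcube b v
  Σcube-product a b u v =
    trans (∑-cong (cube a) (λ x → ∑-*ˡ (cube b) (u x) v)) (∑-*ʳ (cube a) (Σcube b v) u)

  ⟦∧⟧ : ∀ s t → ⟦ s ∧ t ⟧ ≡ ⟦ s ⟧ * ⟦ t ⟧
  ⟦∧⟧ true  t = sym (*-identityˡ _)
  ⟦∧⟧ false t = sym (zeroˡ _)

  ∅-empty : ∀ m → nonempty (∅ {m}) ≡ false
  ∅-empty zero    = refl
  ∅-empty (suc m) = ∅-empty m

  empty⇒∅ : ∀ {m} (S : Vec Bool m) → nonempty S ≡ false → S ≡ ∅
  empty⇒∅ []          _  = refl
  empty⇒∅ (false ∷ S) eq = cong (false ∷_) (empty⇒∅ S eq)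

  -- the only empty subset is ∅
  Σcube-∅ : ∀ m (H : Vec Bool m → Carrier) → Σcube m (λ Y → ⟦ not (nonempty Y) ⟧ * H Y) ≡ H ∅
  Σcube-∅ zero    H = trans (+-identityʳ _) (*-identityˡ _)
  Σcube-∅ (suc m) H = trans (Σcube-suc m _)
    (trans (∑-cong (cube m) (λ Y → trans (cong (_+ ⟦ not (nonempty Y) ⟧ * H (false ∷ Y)) (zeroˡ (H (true ∷ Y))))
                                        (+-identityˡ _)))
           (Σcube-∅ m (λ Y → H (false ∷ Y))))

  Σcube-nonempty : ∀ m (H : Vec Bool m → Carrier) →
                   Σcube m H ≡ Σcube m (λ Y → ⟦ nonempty Y ⟧ * H Y) + H ∅
  Σcube-nonempty m H = begin
    Σcube m H
      ≡⟨ ∑-cong (cube m) (λ Y → split (nonempty Y) (H Y)) ⟩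
    Σcube m (λ Y → ⟦ nonempty Y ⟧ * H Y + ⟦ not (nonempty Y) ⟧ * H Y)
      ≡⟨ ∑-+ (cube m) _ _ ⟩
    Σcube m (λ Y → ⟦ nonempty Y ⟧ * H Y) + Σcube m (λ Y → ⟦ not (nonempty Y) ⟧ * H Y)
      ≡⟨ cong (Σcube m (λ Y → ⟦ nonempty Y ⟧ * H Y) +_) (Σcube-∅ m H) ⟩
    Σcube m (λ Y → ⟦ nonempty Y ⟧ * H Y) + H ∅
      ∎
    where
    split : ∀ s h → h ≡ ⟦ s ⟧ * h + ⟦ not s ⟧ * h
    split true  h = solve 1 (λ h → h := 𝟙 :* h :+ 𝟘 :* h) refl h
    split false h = solve 1 (λ h → h := 𝟘 :* h :+ 𝟙 :* h) refl h

  Ê : Carrier → Carrier → (Bool → Carrier) → Carrier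
  Ê p q u = p * u true + q * u false

  Σ𝔹 : (Bool → Carrier) → Carrier
  Σ𝔹 u = u true + u false

  Ê-const : ∀ {p q} → p + q ≡ 1# → ∀ c → Ê p q (λ _ → c) ≡ c
  Ê-const {p} {q} total c = trans (sym (distribʳ c p q)) (trans (cong (_* c) total) (*-identityˡ c))

  Ê-*ʳ : ∀ p q (u : Bool → Carrier) c → Ê p q (λ b → u b * c) ≡ Ê p q u * c
  Ê-*ʳ p q u c = solve 5 (λ p q u₁ u₀ c → p :* (u₁ :* c) :+ q :* (u₀ :* c) := (p :* u₁ :+ q :* u₀) :* c)
                   refl p q (u true) (u false) c

  basis : (Bool → Carrier) → Bool → Bool → Carrier
  basis χ t c = if t then χ c else 1#

  -- If {1, χ} is orthonormal for the weights p, q (p + q = 1, E χ = 0 and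
  -- χ(true)χ(false) = -1, which given the former is E χ² = 1), then every function
  -- of one bit has a Fourier expansion in this basis and Parseval's identity holds.
  -- Each identity is a polynomial one once the three relations are substituted.
  module OrthonormalBit {p q : Carrier} {χ : Bool → Carrier}
    (total : p + q ≡ 1#) (centred : p * χ true + q * χ false ≡ 0#) (unit : χ true * χ false ≡ - 1#) where

    ĉ : (Bool → Carrier) → Bool → Carrier
    ĉ u t = Ê p q (λ c → u c * basis χ t c)

    expansion : ∀ u c → u c ≡ Σ𝔹 (λ t → ĉ u t * basis χ t c)
    expansion u true = sym (begin
      (p * (u₁ * a) + q * (u₀ * b)) * a + (p * (u₁ * 1#) + q * (u₀ * 1#)) * 1#
        ≡⟨ solve 6 (λ p q a b u₁ u₀ →
             (p :* (u₁ :* a) :+ q :* (u₀ :* b)) :* a :+ (p :* (u₁ :* 𝟙) :+ q :* (u₀ :* 𝟙)) :* 𝟙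
             := u₁ :* (p :+ q) :+ (p :* a :+ q :* b) :* (a :* u₁) :+ q :* (u₀ :- u₁) :* (𝟙 :+ a :* b))
             refl p q a b u₁ u₀ ⟩
      u₁ * (p + q) + (p * a + q * b) * (a * u₁) + q * (u₀ - u₁) * (1# + a * b)
        ≡⟨ cong₃ (λ s m n → u₁ * s + m * (a * u₁) + q * (u₀ - u₁) * (1# + n)) total centred unit ⟩
      u₁ * 1# + 0# * (a * u₁) + q * (u₀ - u₁) * (1# + - 1#)
        ≡⟨ solve 4 (λ q a u₁ u₀ → u₁ :* 𝟙 :+ 𝟘 :* (a :* u₁) :+ q :* (u₀ :- u₁) :* (𝟙 :+ :- 𝟙) := u₁)
             refl q a u₁ u₀ ⟩
      u₁ ∎)
      where
      a = χ true
      b = χ false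
      u₁ = u true
      u₀ = u false
    expansion u false = sym (begin
      (p * (u₁ * a) + q * (u₀ * b)) * b + (p * (u₁ * 1#) + q * (u₀ * 1#)) * 1#
        ≡⟨ solve 6 (λ p q a b u₁ u₀ →
             (p :* (u₁ :* a) :+ q :* (u₀ :* b)) :* b :+ (p :* (u₁ :* 𝟙) :+ q :* (u₀ :* 𝟙)) :* 𝟙
             := u₀ :* (p :+ q) :+ (p :* a :+ q :* b) :* (b :* u₀) :+ p :* (u₁ :- u₀) :* (𝟙 :+ a :* b))
             refl p q a b u₁ u₀ ⟩
      u₀ * (p + q) + (p * a + q * b) * (b * u₀) + p * (u₁ - u₀) * (1# + a * b)
        ≡⟨ cong₃ (λ s m n → u₀ * s + m * (b * u₀) + p * (u₁ - u₀) * (1# + n)) total centred unit ⟩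
      u₀ * 1# + 0# * (b * u₀) + p * (u₁ - u₀) * (1# + - 1#)
        ≡⟨ solve 4 (λ p b u₁ u₀ → u₀ :* 𝟙 :+ 𝟘 :* (b :* u₀) :+ p :* (u₁ :- u₀) :* (𝟙 :+ :- 𝟙) := u₀)
             refl p b u₁ u₀ ⟩
      u₀ ∎)
      where
      a = χ true
      b = χ false
      u₁ = u true
      u₀ = u false

    parseval : ∀ u → Σ𝔹 (λ t → ĉ u t ²) ≡ Ê p q (λ c → u c ²)
    parseval u = begin
      (p * (u₁ * a) + q * (u₀ * b)) ² + (p * (u₁ * 1#) + q * (u₀ * 1#)) ²
        ≡⟨ solve 6 (λ p q a b u₁ u₀ →
             (p :* (u₁ :* a) :+ q :* (u₀ :* b)) :* (p :* (u₁ :* a) :+ q :* (u₀ :* b))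
               :+ (p :* (u₁ :* 𝟙) :+ q :* (u₀ :* 𝟙)) :* (p :* (u₁ :* 𝟙) :+ q :* (u₀ :* 𝟙))
             := (p :* (u₁ :* u₁) :+ q :* (u₀ :* u₀)) :* (p :+ q)
                  :+ (p :* a :+ q :* b) :* (p :* a :* (u₁ :* u₁) :+ q :* b :* (u₀ :* u₀))
                  :- p :* q :* (𝟙 :+ a :* b) :* ((u₁ :- u₀) :* (u₁ :- u₀)))
             refl p q a b u₁ u₀ ⟩
      E² * (p + q) + (p * a + q * b) * V - p * q * (1# + a * b) * D
        ≡⟨ cong₃ (λ s m n → E² * s + m * V - p * q * (1# + n) * D) total centred unit ⟩
      E² * 1# + 0# * V - p * q * (1# + - 1#) * D
        ≡⟨ solve 5 (λ e v p q d → e :* 𝟙 :+ 𝟘 :* v :- p :* q :* (𝟙 :+ :- 𝟙) :* d := e) refl E² V p q D ⟩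
      E² ∎
      where
      a = χ true
      b = χ false
      u₁ = u true
      u₀ = u false
      E² = p * (u₁ * u₁) + q * (u₀ * u₀)
      V = p * a * (u₁ * u₁) + q * b * (u₀ * u₀)
      D = (u₁ - u₀) * (u₁ - u₀)

  -- A ±1 bit of mean e: weight pr e c = (1 + e·c)/2 at c, expectation E₁ e,
  -- normalised bit (c - e)/√(1 - e²), and basis φ₁ e, which is exactly the factor
  -- contributed by one coordinate to prob and to φ.
  pr : Carrier → Bool → Carrier
  pr e c = (1# + e * ± c) * 2# ⁻¹

  E₁ : Carrier → (Bool → Carrier) → Carrier
  E₁ e = Ê (pr e true) (pr e false)

  bit : Carrier → Bool → Carrier
  bit e c = (± c - e) * ρ e

  φ₁ : Carrier → Bool → Bool → Carrier
  φ₁ e = basis (bit e)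

  pr-total : ∀ e → pr e true + pr e false ≡ 1#
  pr-total e = trans
    (solve 2 (λ e h → (𝟙 :+ e :* 𝟙) :* h :+ (𝟙 :+ e :* :- 𝟙) :* h := (𝟙 :+ 𝟙) :* h) refl e (2# ⁻¹)) 2*½

  bit-centred : ∀ e → pr e true * bit e true + pr e false * bit e false ≡ 0#
  bit-centred e = solve 3 (λ e h r →
    (𝟙 :+ e :* 𝟙) :* h :* ((𝟙 :- e) :* r) :+ (𝟙 :+ e :* :- 𝟙) :* h :* ((:- 𝟙 :- e) :* r) := 𝟘) refl e (2# ⁻¹) (ρ e)

  bit-unit : ∀ e → Nondegenerate e → bit e true * bit e false ≡ - 1#
  bit-unit e nd = trans
    (solve 2 (λ e r → (𝟙 :- e) :* r :* ((:- 𝟙 :- e) :* r) := :- ((𝟙 :- e :* e) :* (r :* r))) refl e (ρ e))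
    (cong -_ nd)

  module BiasedBit (e : Carrier) (nd : Nondegenerate e) = OrthonormalBit {χ = bit e} (pr-total e) (bit-centred e) (bit-unit e nd)

  E-cong : ∀ {m} (μ : Vec Carrier m) {F G : Vec Bool m → Carrier} → (∀ x → F x ≡ G x) → E μ F ≡ E μ G
  E-cong {m} μ F≡G = ∑-cong (cube m) (λ x → cong (prob μ x *_) (F≡G x))

  E-+ : ∀ {m} (μ : Vec Carrier m) (F G : Vec Bool m → Carrier) → E μ (λ x → F x + G x) ≡ E μ F + E μ G
  E-+ {m} μ F G = trans (∑-cong (cube m) (λ x → distribˡ (prob μ x) (F x) (G x))) (∑-+ (cube m) _ _)

  E-*ˡ : ∀ {m} (μ : Vec Carrier m) (c : Carrier) (F : Vec Bool m → Carrier) → E μ (λ x → c * F x) ≡ c * E μ F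
  E-*ˡ {m} μ c F = trans
    (∑-cong (cube m) (λ x → solve 3 (λ p c f → p :* (c :* f) := c :* (p :* f)) refl (prob μ x) c (F x)))
    (∑-*ˡ (cube m) c _)

  E-*ʳ : ∀ {m} (μ : Vec Carrier m) (c : Carrier) (F : Vec Bool m → Carrier) → E μ (λ x → F x * c) ≡ E μ F * c
  E-*ʳ μ c F = trans (E-cong μ (λ x → *-comm (F x) c)) (trans (E-*ˡ μ c F) (*-comm c (E μ F)))

  E-Σ𝔹 : ∀ {m} (μ : Vec Carrier m) (H : Bool → Vec Bool m → Carrier) →
         E μ (λ x → Σ𝔹 (λ t → H t x)) ≡ Σ𝔹 (λ t → E μ (H t))
  E-Σ𝔹 μ H = E-+ μ (H true) (H false)

  E-Ê : ∀ {m} (μ : Vec Carrier m) p q (K : Bool → Vec Bool m → Carrier) →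
        E μ (λ x → Ê p q (λ c → K c x)) ≡ Ê p q (λ c → E μ (K c))
  E-Ê μ p q K = trans (E-+ μ _ _) (cong₂ _+_ (E-*ˡ μ p (K true)) (E-*ˡ μ q (K false)))

  E-cons : ∀ {m} e (μ : Vec Carrier m) (H : Vec Bool (suc m) → Carrier) →
           E (e ∷ μ) H ≡ E μ (λ x → E₁ e (λ c → H (c ∷ x)))
  E-cons {m} e μ H = trans (Σcube-suc m _) (∑-cong (cube m) (λ x →
    solve 5 (λ p q π h₁ h₀ → p :* π :* h₁ :+ q :* π :* h₀ := π :* (p :* h₁ :+ q :* h₀))
      refl (pr e true) (pr e false) (prob μ x) (H (true ∷ x)) (H (false ∷ x))))

  E-++ : ∀ {a b} (μ : Vec Carrier a) (ν : Vec Carrier b) (H : Vec Bool (a ℕ.+ b) → Carrier) →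
         E (μ ++ ν) H ≡ E μ (λ x → E ν (λ y → H (x ++ y)))
  E-++ []      ν H = sym (trans (+-identityʳ _) (*-identityˡ _))
  E-++ (e ∷ μ) ν H = begin
    E (e ∷ μ ++ ν) H                                     ≡⟨ E-cons e (μ ++ ν) H ⟩
    E (μ ++ ν) (λ z → E₁ e (λ c → H (c ∷ z)))            ≡⟨ E-++ μ ν _ ⟩
    E μ (λ x → E ν (λ y → E₁ e (λ c → H (c ∷ x ++ y))))  ≡⟨ E-cong μ (λ x → E-Ê ν _ _ (λ c y → H (c ∷ x ++ y))) ⟩
    E μ (λ x → E₁ e (λ c → E ν (λ y → H (c ∷ x ++ y))))  ≡⟨ sym (E-cons e μ _) ⟩
    E (e ∷ μ) (λ x → E ν (λ y → H (x ++ y)))             ∎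

  E-product : ∀ {a b} (μ : Vec Carrier a) (ν : Vec Carrier b) (u : Vec Bool a → Carrier) (v : Vec Bool b → Carrier) →
              E μ (λ x → E ν (λ y → u x * v y)) ≡ E μ u * E ν v
  E-product μ ν u v = trans (E-cong μ (λ x → E-*ˡ ν (u x) v)) (E-*ʳ μ (E ν v) u)

  E-one : ∀ {m} (μ : Vec Carrier m) → E μ (λ _ → 1#) ≡ 1#
  E-one []      = trans (+-identityʳ _) (*-identityˡ _)
  E-one (e ∷ μ) = trans (E-cons e μ _) (trans (E-cong μ (λ _ → Ê-const (pr-total e) 1#)) (E-one μ))

  φ-++ : ∀ {a b} (μ : Vec Carrier a) (ν : Vec Carrier b) S T x y →
         φ (μ ++ ν) (S ++ T) (x ++ y) ≡ φ μ S x * φ ν T y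
  φ-++ []      ν []      T []      y = sym (*-identityˡ _)
  φ-++ (e ∷ μ) ν (s ∷ S) T (c ∷ x) y = trans (cong (φ₁ e s c *_) (φ-++ μ ν S T x y)) (sym (*-assoc _ _ _))

  φ-∅ : ∀ {m} (μ : Vec Carrier m) x → φ μ ∅ x ≡ 1#
  φ-∅ []      []      = refl
  φ-∅ (e ∷ μ) (c ∷ x) = trans (*-identityˡ _) (φ-∅ μ x)

  E-φ : ∀ {m} (μ : Vec Carrier m) S → E μ (φ μ S) ≡ ⟦ not (nonempty S) ⟧
  E-φ []      []      = trans (+-identityʳ _) (*-identityˡ _)
  E-φ (e ∷ μ) (s ∷ S) = begin
    E (e ∷ μ) (φ (e ∷ μ) (s ∷ S))                ≡⟨ E-cons e μ _ ⟩
    E μ (λ x → E₁ e (λ c → φ₁ e s c * φ μ S x))  ≡⟨ E-cong μ (λ x → Ê-*ʳ _ _ (φ₁ e s) (φ μ S x)) ⟩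
    E μ (λ x → E₁ e (φ₁ e s) * φ μ S x)          ≡⟨ E-*ˡ μ _ (φ μ S) ⟩
    E₁ e (φ₁ e s) * E μ (φ μ S)                  ≡⟨ cong (E₁ e (φ₁ e s) *_) (E-φ μ S) ⟩
    E₁ e (φ₁ e s) * ⟦ not (nonempty S) ⟧         ≡⟨ head s ⟩
    ⟦ not (s ∨ nonempty S) ⟧                     ∎
    where
    head : ∀ s → E₁ e (φ₁ e s) * ⟦ not (nonempty S) ⟧ ≡ ⟦ not (s ∨ nonempty S) ⟧
    head true  = trans (cong (_* ⟦ not (nonempty S) ⟧) (bit-centred e)) (zeroˡ _)
    head false = trans (cong (_* ⟦ not (nonempty S) ⟧) (Ê-const (pr-total e) 1#)) (*-identityˡ _)

  coeffℝ : ∀ {m} → Vec Carrier m → (Vec Bool m → Carrier) → Vec Bool m → Carrier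
  coeffℝ μ G S = E μ (λ x → G x * φ μ S x)

  coeffℝ-cons : ∀ {m} e (μ : Vec Carrier m) (G : Vec Bool (suc m) → Carrier) s T →
    coeffℝ (e ∷ μ) G (s ∷ T) ≡ coeffℝ μ (λ z → E₁ e (λ c → G (c ∷ z) * φ₁ e s c)) T
  coeffℝ-cons e μ G s T = trans (E-cons e μ _) (E-cong μ (λ z → trans
    (cong₂ _+_ (cong (pr e true *_) (sym (*-assoc _ _ _))) (cong (pr e false *_) (sym (*-assoc _ _ _))))
    (Ê-*ʳ _ _ (λ c → G (c ∷ z) * φ₁ e s c) (φ μ T z))))

  coeffℝ-∅ : ∀ {m} (μ : Vec Carrier m) G → coeffℝ μ G ∅ ≡ E μ G
  coeffℝ-∅ μ G = E-cong μ (λ x → trans (cong (G x *_) (φ-∅ μ x)) (*-identityʳ (G x)))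

  parseval : ∀ {m} (μ : Vec Carrier m) → All Nondegenerate μ → (G : Vec Bool m → Carrier) →
             Σcube m (λ S → coeffℝ μ G S ²) ≡ E μ (λ x → G x ²)
  parseval []      []         G = solve 1 (λ g →
    (𝟙 :* (g :* 𝟙) :+ 𝟘) :* (𝟙 :* (g :* 𝟙) :+ 𝟘) :+ 𝟘 := 𝟙 :* (g :* g) :+ 𝟘) refl (G [])
  parseval {suc m} (e ∷ μ) (nd ∷ nds) G = begin
    Σcube (suc m) (λ S → coeffℝ (e ∷ μ) G S ²)
      ≡⟨ Σcube-suc m _ ⟩
    Σcube m (λ S → coeffℝ (e ∷ μ) G (true ∷ S) ² + coeffℝ (e ∷ μ) G (false ∷ S) ²)
      ≡⟨ ∑-cong (cube m) (λ S → cong₂ _+_ (cong _² (coeffℝ-cons e μ G true S))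
                                          (cong _² (coeffℝ-cons e μ G false S))) ⟩
    Σcube m (λ S → Σ𝔹 (λ t → coeffℝ μ (Ĝ t) S ²))
      ≡⟨ ∑-+ (cube m) _ _ ⟩
    Σ𝔹 (λ t → Σcube m (λ S → coeffℝ μ (Ĝ t) S ²))
      ≡⟨ cong₂ _+_ (parseval μ nds (Ĝ true)) (parseval μ nds (Ĝ false)) ⟩
    Σ𝔹 (λ t → E μ (λ z → Ĝ t z ²))
      ≡⟨ sym (E-Σ𝔹 μ (λ t z → Ĝ t z ²)) ⟩
    E μ (λ z → Σ𝔹 (λ t → Ĝ t z ²))
      ≡⟨ E-cong μ (λ z → BiasedBit.parseval e nd (λ c → G (c ∷ z))) ⟩
    E μ (λ z → E₁ e (λ c → G (c ∷ z) ²))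
      ≡⟨ sym (E-cons e μ _) ⟩
    E (e ∷ μ) (λ x → G x ²)
      ∎
    where
    Ĝ : Bool → Vec Bool m → Carrier
    Ĝ t z = E₁ e (λ c → G (c ∷ z) * φ₁ e t c)

  take-++ : ∀ {A : Set} {a b} (xs : Vec A a) (ys : Vec A b) → take a (xs ++ ys) ≡ xs
  take-++ []       ys = refl
  take-++ (x ∷ xs) ys = cong (x ∷_) (take-++ xs ys)

  drop-++ : ∀ {A : Set} {a b} (xs : Vec A a) (ys : Vec A b) → drop a (xs ++ ys) ≡ ys
  drop-++ []       ys = refl
  drop-++ (x ∷ xs) ys = drop-++ xs ys

  by-blocks : ∀ {A : Set} {a b} (P : Vec A (a ℕ.+ b) → Set) → (∀ xs ys → P (xs ++ ys)) → ∀ zs → P zs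
  by-blocks {a = a} P P++ zs = subst P (take++drop≡id a zs) (P++ (take a zs) (drop a zs))

  nonempty-++ : ∀ {a b} (xs : Vec Bool a) (ys : Vec Bool b) → nonempty (xs ++ ys) ≡ nonempty xs ∨ nonempty ys
  nonempty-++ []       ys = refl
  nonempty-++ (x ∷ xs) ys = trans (cong (x ∨_) (nonempty-++ xs ys)) (sym (∨-assoc x _ _))

  eqᵇ-sound : ∀ {m} (S T : Vec Bool m) → eqᵇ S T ≡ true → S ≡ T
  eqᵇ-sound []          []          _  = refl
  eqᵇ-sound (true ∷ S)  (true ∷ T)  eq = cong (true ∷_) (eqᵇ-sound S T eq)
  eqᵇ-sound (false ∷ S) (false ∷ T) eq = cong (false ∷_) (eqᵇ-sound S T eq)

  agree : Bool → Bool → Bool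
  agree s t = if s then t else (if t then false else true)

  agree-false : ∀ s → agree s false ≡ not s
  agree-false true  = refl
  agree-false false = refl

  select : ∀ s (X : Bool → Carrier) → Σ𝔹 (λ t → ⟦ agree s t ⟧ * X t) ≡ X s
  select true  X = solve 2 (λ a b → 𝟙 :* a :+ 𝟘 :* b := a) refl (X true) (X false)
  select false X = solve 2 (λ a b → 𝟘 :* a :+ 𝟙 :* b := b) refl (X true) (X false)

  mean : ∀ {m} → Vec Carrier m → (Vec Bool m → Bool) → Carrier
  mean μ g = E μ (λ x → ± (g x))

  means : (k : ℕ) (n : Fin k → ℕ) → ((i : Fin k) → Vec Bool (n i) → Bool) →
          ((i : Fin k) → Vec Carrier (n i)) → Vec Carrier k
  means k n g μ = tabulate (λ i → mean (μ i) (g i))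

  inner : (k : ℕ) (n : Fin k → ℕ) → ((i : Fin k) → Vec Bool (n i) → Bool) → Vec Bool (total k n) → Vec Bool k
  inner k n g x = tabulate (λ i → g i (block k n x i))

  inner-++ : ∀ k (n : Fin (suc k) → ℕ) g (x₀ : Vec Bool (n zero)) x′ →
             inner (suc k) n g (x₀ ++ x′) ≡ g zero x₀ ∷ inner k (λ i → n (suc i)) (λ i → g (suc i)) x′
  inner-++ k n g x₀ x′ =
    cong₂ _∷_ (cong (g zero) (take-++ x₀ x′)) (cong (inner k (λ i → n (suc i)) (λ i → g (suc i))) (drop-++ x₀ x′))

  blockWeight : ∀ {m} → Vec Carrier m → (Vec Bool m → Bool) → Vec Bool m → Carrier
  blockWeight μ g Y = if nonempty Y then coeff μ g Y * ρ (mean μ g) else 1#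

  weight : (k : ℕ) (n : Fin k → ℕ) → ((i : Fin k) → Vec Bool (n i) → Bool) →
           ((i : Fin k) → Vec Carrier (n i)) → Vec Bool (total k n) → Carrier
  weight k n g μ Y = prodV (tabulate (λ i → blockWeight (μ i) (g i) (block k n Y i)))

  blockCorrelation : ∀ {m} (μ : Vec Carrier m) (g : Vec Bool m → Bool) t Y →
    E μ (λ x → φ₁ (mean μ g) t (g x) * φ μ Y x) ≡ ⟦ agree (nonempty Y) t ⟧ * blockWeight μ g Y
  blockCorrelation μ g false Y =
    trans (E-cong μ (λ x → *-identityˡ _)) (trans (E-φ μ Y) (constant (nonempty Y) (coeff μ g Y * ρ (mean μ g))))
    where
    constant : ∀ s w → ⟦ not s ⟧ ≡ ⟦ agree s false ⟧ * (if s then w else 1#)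
    constant true  w = sym (zeroˡ w)
    constant false w = sym (*-identityˡ 1#)
  blockCorrelation μ g true Y = trans linear (centred (nonempty Y) refl)
    where
    η = mean μ g
    linear : E μ (λ x → φ₁ η true (g x) * φ μ Y x) ≡ coeff μ g Y * ρ η + - (η * ρ η) * ⟦ not (nonempty Y) ⟧
    linear = begin
      E μ (λ x → (± (g x) - η) * ρ η * φ μ Y x)
        ≡⟨ E-cong μ (λ x → solve 4 (λ a e r f → (a :- e) :* r :* f := a :* f :* r :+ :- (e :* r) :* f)
                              refl (± (g x)) η (ρ η) (φ μ Y x)) ⟩
      E μ (λ x → ± (g x) * φ μ Y x * ρ η + - (η * ρ η) * φ μ Y x)
        ≡⟨ E-+ μ _ _ ⟩
      E μ (λ x → ± (g x) * φ μ Y x * ρ η) + E μ (λ x → - (η * ρ η) * φ μ Y x)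
        ≡⟨ cong₂ _+_ (E-*ʳ μ (ρ η) _) (trans (E-*ˡ μ _ (φ μ Y)) (cong (- (η * ρ η) *_) (E-φ μ Y))) ⟩
      coeff μ g Y * ρ η + - (η * ρ η) * ⟦ not (nonempty Y) ⟧
        ∎
    centred : ∀ s → nonempty Y ≡ s →
      coeff μ g Y * ρ η + - (η * ρ η) * ⟦ not s ⟧ ≡ ⟦ agree s true ⟧ * (if s then coeff μ g Y * ρ η else 1#)
    centred true  _     = solve 3 (λ c e r → c :* r :+ :- (e :* r) :* 𝟘 := 𝟙 :* (c :* r)) refl (coeff μ g Y) η (ρ η)
    centred false empty = begin
      coeff μ g Y * ρ η + - (η * ρ η) * 1#   ≡⟨ cong (λ Z → coeff μ g Z * ρ η + - (η * ρ η) * 1#) (empty⇒∅ Y empty) ⟩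
      coeff μ g ∅ * ρ η + - (η * ρ η) * 1#   ≡⟨ cong (λ c → c * ρ η + - (η * ρ η) * 1#) (coeffℝ-∅ μ _) ⟩
      η * ρ η + - (η * ρ η) * 1#             ≡⟨ solve 2 (λ e r → e :* r :+ :- (e :* r) :* 𝟙 := 𝟘 :* 𝟙) refl η (ρ η) ⟩
      0# * 1#                                ∎

  E-separate : ∀ {a b} (μ : Vec Carrier a) (ν : Vec Carrier b)
               (u : Bool → Vec Bool a → Carrier) (v : Bool → Vec Bool b → Carrier) →
               E μ (λ x → E ν (λ y → Σ𝔹 (λ t → u t x * v t y))) ≡ Σ𝔹 (λ t → E μ (u t) * E ν (v t))
  E-separate μ ν u v = trans (E-cong μ (λ x → E-Σ𝔹 ν (λ t y → u t x * v t y)))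
    (trans (E-Σ𝔹 μ (λ t x → E ν (λ y → u t x * v t y)))
           (cong₂ _+_ (E-product μ ν (u true) (v true)) (E-product μ ν (u false) (v false))))

  -- Induction on the number of blocks: expand F in the first outer
  -- bit, separate the first block from the rest, and apply blockCorrelation.
  compositionCoeff : ∀ k n g μ → All Nondegenerate (means k n g μ) →
    (F : Vec Bool k → Carrier) (Y : Vec Bool (total k n)) →
    coeffℝ (concatBlocks k n μ) (λ x → F (inner k n g x)) Y ≡
    coeffℝ (means k n g μ) F (blockPattern k n Y) * weight k n g μ Y
  compositionCoeff zero    n g μ []         F [] = sym (*-identityʳ _)
  compositionCoeff (suc k) n g μ (nd₀ ∷ nds) F = by-blocks _ composed
    where
    n′ = λ i → n (suc i)
    g′ = λ i → g (suc i)
    μ′ = λ i → μ (suc i)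
    μ₀ = μ zero
    g₀ = g zero
    η₀ = mean μ₀ g₀
    μh′ = concatBlocks k n′ μ′
    η′ = means k n′ g′ μ′

    A : Bool → Vec Bool k → Carrier
    A t z = E₁ η₀ (λ c → F (c ∷ z) * φ₁ η₀ t c)

    expanded : ∀ Y₀ Y′ x₀ x′ →
      F (inner (suc k) n g (x₀ ++ x′)) * φ (μ₀ ++ μh′) (Y₀ ++ Y′) (x₀ ++ x′) ≡
      Σ𝔹 (λ t → (φ₁ η₀ t (g₀ x₀) * φ μ₀ Y₀ x₀) * (A t (inner k n′ g′ x′) * φ μh′ Y′ x′))
    expanded Y₀ Y′ x₀ x′ = begin
      F (inner (suc k) n g (x₀ ++ x′)) * φ (μ₀ ++ μh′) (Y₀ ++ Y′) (x₀ ++ x′)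
        ≡⟨ cong₂ _*_ (cong F (inner-++ k n g x₀ x′)) (φ-++ μ₀ μh′ Y₀ Y′ x₀ x′) ⟩
      F (g₀ x₀ ∷ z) * (φ μ₀ Y₀ x₀ * φ μh′ Y′ x′)
        ≡⟨ cong (_* (φ μ₀ Y₀ x₀ * φ μh′ Y′ x′)) (BiasedBit.expansion η₀ nd₀ (λ c → F (c ∷ z)) (g₀ x₀)) ⟩
      Σ𝔹 (λ t → A t z * φ₁ η₀ t (g₀ x₀)) * (φ μ₀ Y₀ x₀ * φ μh′ Y′ x′)
        ≡⟨ solve 6 (λ a₁ ψ₁ a₀ ψ₀ f f′ → (a₁ :* ψ₁ :+ a₀ :* ψ₀) :* (f :* f′) := ψ₁ :* f :* (a₁ :* f′) :+ ψ₀ :* f :* (a₀ :* f′))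
             refl (A true z) (φ₁ η₀ true (g₀ x₀)) (A false z) (φ₁ η₀ false (g₀ x₀)) (φ μ₀ Y₀ x₀) (φ μh′ Y′ x′) ⟩
      Σ𝔹 (λ t → (φ₁ η₀ t (g₀ x₀) * φ μ₀ Y₀ x₀) * (A t z * φ μh′ Y′ x′))
        ∎
      where z = inner k n′ g′ x′

    composed : ∀ Y₀ Y′ →
      coeffℝ (concatBlocks (suc k) n μ) (λ x → F (inner (suc k) n g x)) (Y₀ ++ Y′) ≡
      coeffℝ (means (suc k) n g μ) F (blockPattern (suc k) n (Y₀ ++ Y′)) * weight (suc k) n g μ (Y₀ ++ Y′)
    composed Y₀ Y′ = begin
      coeffℝ (μ₀ ++ μh′) (λ x → F (inner (suc k) n g x)) (Y₀ ++ Y′)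
        ≡⟨ E-++ μ₀ μh′ _ ⟩
      E μ₀ (λ x₀ → E μh′ (λ x′ → F (inner (suc k) n g (x₀ ++ x′)) * φ (μ₀ ++ μh′) (Y₀ ++ Y′) (x₀ ++ x′)))
        ≡⟨ E-cong μ₀ (λ x₀ → E-cong μh′ (expanded Y₀ Y′ x₀)) ⟩
      E μ₀ (λ x₀ → E μh′ (λ x′ → Σ𝔹 (λ t → (φ₁ η₀ t (g₀ x₀) * φ μ₀ Y₀ x₀) * (A t (inner k n′ g′ x′) * φ μh′ Y′ x′))))
        ≡⟨ E-separate μ₀ μh′ (λ t x₀ → φ₁ η₀ t (g₀ x₀) * φ μ₀ Y₀ x₀) (λ t x′ → A t (inner k n′ g′ x′) * φ μh′ Y′ x′) ⟩
      Σ𝔹 (λ t → E μ₀ (λ x₀ → φ₁ η₀ t (g₀ x₀) * φ μ₀ Y₀ x₀) * coeffℝ μh′ (λ x′ → A t (inner k n′ g′ x′)) Y′)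
        ≡⟨ cong₂ _+_ (cong₂ _*_ (blockCorrelation μ₀ g₀ true Y₀) (compositionCoeff k n′ g′ μ′ nds (A true) Y′))
                     (cong₂ _*_ (blockCorrelation μ₀ g₀ false Y₀) (compositionCoeff k n′ g′ μ′ nds (A false) Y′)) ⟩
      Σ𝔹 (λ t → (⟦ agree (nonempty Y₀) t ⟧ * w₀) * (coeffℝ η′ (A t) P′ * w′))
        ≡⟨ cong₂ _+_ (regroup true) (regroup false) ⟩
      Σ𝔹 (λ t → ⟦ agree (nonempty Y₀) t ⟧ * (coeffℝ η′ (A t) P′ * (w₀ * w′)))
        ≡⟨ select (nonempty Y₀) (λ t → coeffℝ η′ (A t) P′ * (w₀ * w′)) ⟩
      coeffℝ η′ (A (nonempty Y₀)) P′ * (w₀ * w′)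
        ≡⟨ cong (_* (w₀ * w′)) (sym (coeffℝ-cons η₀ η′ F (nonempty Y₀) P′)) ⟩
      coeffℝ (η₀ ∷ η′) F (nonempty Y₀ ∷ P′) * (w₀ * w′)
        ≡⟨ sym (cong₂ (λ Z₀ Z′ → coeffℝ (η₀ ∷ η′) F (nonempty Z₀ ∷ blockPattern k n′ Z′)
                                  * (blockWeight μ₀ g₀ Z₀ * weight k n′ g′ μ′ Z′))
                      (take-++ Y₀ Y′) (drop-++ Y₀ Y′)) ⟩
      coeffℝ (means (suc k) n g μ) F (blockPattern (suc k) n (Y₀ ++ Y′)) * weight (suc k) n g μ (Y₀ ++ Y′)
        ∎
      where
      w₀ = blockWeight μ₀ g₀ Y₀
      w′ = weight k n′ g′ μ′ Y′
      P′ = blockPattern k n′ Y′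
      regroup : ∀ t → (⟦ agree (nonempty Y₀) t ⟧ * w₀) * (coeffℝ η′ (A t) P′ * w′) ≡
                      ⟦ agree (nonempty Y₀) t ⟧ * (coeffℝ η′ (A t) P′ * (w₀ * w′))
      regroup t = solve 4 (λ a w c w′ → a :* w :* (c :* w′) := a :* (c :* (w :* w′))) refl
                    ⟦ agree (nonempty Y₀) t ⟧ w₀ (coeffℝ η′ (A t) P′) w′

  ±² : ∀ b → ± b ² ≡ 1#
  ±² true  = *-identityˡ 1#
  ±² false = solve 0 (:- 𝟙 :* :- 𝟙 := 𝟙) refl

  -- Within one block, the squared weights of the subsets Y with (Y ≠ ∅) = t sum to 1:
  -- for t = false only Y = ∅ counts, for t = true this is Parseval for ± ∘ g.
  blockMass : ∀ {m} (μ : Vec Carrier m) (g : Vec Bool m → Bool) →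
              All Nondegenerate μ → Nondegenerate (mean μ g) → ∀ t →
              Σcube m (λ Y → ⟦ agree (nonempty Y) t ⟧ * blockWeight μ g Y ²) ≡ 1#
  blockMass {m} μ g _ _ false = begin
    Σcube m (λ Y → ⟦ agree (nonempty Y) false ⟧ * blockWeight μ g Y ²)
      ≡⟨ ∑-cong (cube m) (λ Y → cong (λ s → ⟦ s ⟧ * blockWeight μ g Y ²) (agree-false (nonempty Y))) ⟩
    Σcube m (λ Y → ⟦ not (nonempty Y) ⟧ * blockWeight μ g Y ²)
      ≡⟨ Σcube-∅ m (λ Y → blockWeight μ g Y ²) ⟩
    blockWeight μ g ∅ ²
      ≡⟨ cong (λ s → (if s then coeff μ g ∅ * ρ (mean μ g) else 1#) ²) (∅-empty m) ⟩
    1# * 1#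
      ≡⟨ *-identityˡ 1# ⟩
    1# ∎
  blockMass {m} μ g ndμ ndη true = begin
    Σcube m (λ Y → ⟦ agree (nonempty Y) true ⟧ * blockWeight μ g Y ²)
      ≡⟨ ∑-cong (cube m) (λ Y → nonemptyWeight (nonempty Y) (coeff μ g Y)) ⟩
    Σcube m (λ Y → ⟦ nonempty Y ⟧ * (coeff μ g Y ² * ρ η ²))
      ≡⟨ subtract (Σcube-nonempty m (λ Y → coeff μ g Y ² * ρ η ²)) ⟩
    Σcube m (λ Y → coeff μ g Y ² * ρ η ²) - coeff μ g ∅ ² * ρ η ²
      ≡⟨ cong₂ (λ a c → a - c ² * ρ η ²) (∑-*ʳ (cube m) (ρ η ²) (λ Y → coeff μ g Y ²)) (coeffℝ-∅ μ _) ⟩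
    Σcube m (λ Y → coeff μ g Y ²) * ρ η ² - η ² * ρ η ²
      ≡⟨ cong (λ a → a * ρ η ² - η ² * ρ η ²) (parseval μ ndμ (λ x → ± (g x))) ⟩
    E μ (λ x → ± (g x) ²) * ρ η ² - η ² * ρ η ²
      ≡⟨ cong (λ a → a * ρ η ² - η ² * ρ η ²) (trans (E-cong μ (λ x → ±² (g x))) (E-one μ)) ⟩
    1# * ρ η ² - η ² * ρ η ²
      ≡⟨ solve 2 (λ e r → 𝟙 :* (r :* r) :- e :* e :* (r :* r) := (𝟙 :- e :* e) :* (r :* r)) refl η (ρ η) ⟩
    (1# - η ²) * ρ η ²
      ≡⟨ ndη ⟩
    1# ∎
    where
    η = mean μ g
    nonemptyWeight : ∀ s c → ⟦ agree s true ⟧ * (if s then c * ρ η else 1#) ² ≡ ⟦ s ⟧ * (c ² * ρ η ²)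
    nonemptyWeight true  c = solve 2 (λ c r → 𝟙 :* (c :* r :* (c :* r)) := 𝟙 :* (c :* c :* (r :* r))) refl c (ρ η)
    nonemptyWeight false c = trans (zeroˡ _) (sym (zeroˡ _))
    subtract : ∀ {x y z} → x ≡ y + z → y ≡ x - z
    subtract {x} {y} {z} x≡y+z =
      trans (solve 2 (λ y z → y := y :+ z :- z) refl y z) (cong (_- z) (sym x≡y+z))

  -- Summed over all subsets with a given block pattern T, the squared weights give 1:
  -- the sum factorises over the blocks into instances of blockMass.
  patternMass : ∀ k n g μ → (∀ i → All Nondegenerate (μ i)) → All Nondegenerate (means k n g μ) →
    ∀ T → Σcube (total k n) (λ Y → ⟦ eqᵇ (blockPattern k n Y) T ⟧ * weight k n g μ Y ²) ≡ 1#
  patternMass zero    n g μ _   []          [] = solve 0 (𝟙 :* (𝟙 :* 𝟙) :+ 𝟘 := 𝟙) refl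
  patternMass (suc k) n g μ ndμ (nd₀ ∷ nds) (t ∷ T) = begin
    Σcube (n zero ℕ.+ total k n′) (λ Y → ⟦ eqᵇ (blockPattern (suc k) n Y) (t ∷ T) ⟧ * weight (suc k) n g μ Y ²)
      ≡⟨ Σcube-++ (n zero) (total k n′) _ ⟩
    Σcube (n zero) (λ Y₀ → Σcube (total k n′) (λ Y′ →
      ⟦ eqᵇ (blockPattern (suc k) n (Y₀ ++ Y′)) (t ∷ T) ⟧ * weight (suc k) n g μ (Y₀ ++ Y′) ²))
      ≡⟨ ∑-cong (cube (n zero)) (λ Y₀ → ∑-cong (cube (total k n′)) (factorised Y₀)) ⟩
    Σcube (n zero) (λ Y₀ → Σcube (total k n′) (λ Y′ → M₀ Y₀ * M′ Y′))
      ≡⟨ Σcube-product (n zero) (total k n′) M₀ M′ ⟩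
    Σcube (n zero) M₀ * Σcube (total k n′) M′
      ≡⟨ cong₂ _*_ (blockMass (μ zero) (g zero) (ndμ zero) nd₀ t) (patternMass k n′ g′ μ′ (λ i → ndμ (suc i)) nds T) ⟩
    1# * 1#
      ≡⟨ *-identityˡ 1# ⟩
    1# ∎
    where
    n′ = λ i → n (suc i)
    g′ = λ i → g (suc i)
    μ′ = λ i → μ (suc i)
    M₀ : Vec Bool (n zero) → Carrier
    M₀ Y₀ = ⟦ agree (nonempty Y₀) t ⟧ * blockWeight (μ zero) (g zero) Y₀ ²
    M′ : Vec Bool (total k n′) → Carrier
    M′ Y′ = ⟦ eqᵇ (blockPattern k n′ Y′) T ⟧ * weight k n′ g′ μ′ Y′ ²
    factorised : ∀ Y₀ Y′ →
      ⟦ eqᵇ (blockPattern (suc k) n (Y₀ ++ Y′)) (t ∷ T) ⟧ * weight (suc k) n g μ (Y₀ ++ Y′) ² ≡ M₀ Y₀ * M′ Y′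
    factorised Y₀ Y′ = begin
      ⟦ agree (nonempty (take (n zero) Y)) t ∧ eqᵇ (blockPattern k n′ (drop (n zero) Y)) T ⟧
        * (blockWeight (μ zero) (g zero) (take (n zero) Y) * weight k n′ g′ μ′ (drop (n zero) Y)) ²
        ≡⟨ cong₂ (λ Z₀ Z′ → ⟦ agree (nonempty Z₀) t ∧ eqᵇ (blockPattern k n′ Z′) T ⟧
                              * (blockWeight (μ zero) (g zero) Z₀ * weight k n′ g′ μ′ Z′) ²)
                 (take-++ Y₀ Y′) (drop-++ Y₀ Y′) ⟩
      ⟦ agree (nonempty Y₀) t ∧ eqᵇ (blockPattern k n′ Y′) T ⟧ * (w₀ * w′) ²
        ≡⟨ cong (_* (w₀ * w′) ²) (⟦∧⟧ (agree (nonempty Y₀) t) (eqᵇ (blockPattern k n′ Y′) T)) ⟩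
      (a * b) * (w₀ * w′) ²
        ≡⟨ solve 4 (λ a b w w′ → a :* b :* (w :* w′ :* (w :* w′)) := a :* (w :* w) :* (b :* (w′ :* w′))) refl a b w₀ w′ ⟩
      M₀ Y₀ * M′ Y′ ∎
      where
      Y = Y₀ ++ Y′
      w₀ = blockWeight (μ zero) (g zero) Y₀
      w′ = weight k n′ g′ μ′ Y′
      a = ⟦ agree (nonempty Y₀) t ⟧
      b = ⟦ eqᵇ (blockPattern k n′ Y′) T ⟧

  nonempty-pattern : ∀ k n (Y : Vec Bool (total k n)) → nonempty (blockPattern k n Y) ≡ nonempty Y
  nonempty-pattern zero    n [] = refl
  nonempty-pattern (suc k) n Y = begin
    nonempty (take (n zero) Y) ∨ nonempty (blockPattern k n′ (drop (n zero) Y))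
      ≡⟨ cong (nonempty (take (n zero) Y) ∨_) (nonempty-pattern k n′ (drop (n zero) Y)) ⟩
    nonempty (take (n zero) Y) ∨ nonempty (drop (n zero) Y)
      ≡⟨ sym (nonempty-++ (take (n zero) Y) (drop (n zero) Y)) ⟩
    nonempty (take (n zero) Y ++ drop (n zero) Y)
      ≡⟨ cong nonempty (take++drop≡id (n zero) Y) ⟩
    nonempty Y ∎
    where n′ = λ i → n (suc i)

  weight-empty : ∀ k n g μ (Y : Vec Bool (total k n)) → nonempty Y ≡ false → weight k n g μ Y ≡ 1#
  weight-empty zero    n g μ Y _     = refl
  weight-empty (suc k) n g μ Y empty = begin
    (if nonempty Y₀ then coeff (μ zero) (g zero) Y₀ * ρ (mean (μ zero) (g zero)) else 1#)
      * weight k (λ i → n (suc i)) (λ i → g (suc i)) (λ i → μ (suc i)) Y′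
      ≡⟨ cong₂ (λ s w → (if s then coeff (μ zero) (g zero) Y₀ * ρ (mean (μ zero) (g zero)) else 1#) * w)
               (∨-conicalˡ _ _ parts)
               (weight-empty k (λ i → n (suc i)) (λ i → g (suc i)) (λ i → μ (suc i)) Y′ (∨-conicalʳ _ _ parts)) ⟩
    1# * 1#
      ≡⟨ *-identityˡ 1# ⟩
    1# ∎
    where
    Y₀ = take (n zero) Y
    Y′ = drop (n zero) Y
    parts : nonempty Y₀ ∨ nonempty Y′ ≡ false
    parts = trans (sym (nonempty-++ Y₀ Y′)) (trans (cong nonempty (take++drop≡id (n zero) Y)) empty)

  at-pattern : ∀ {m} (P T : Vec Bool m) (X : Vec Bool m → Carrier) c →
               ⟦ eqᵇ P T ⟧ * (X P * c) ≡ X T * (⟦ eqᵇ P T ⟧ * c)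
  at-pattern P T X c with eqᵇ P T in P≟T
  ... | true  = trans (cong (λ Z → 1# * (X Z * c)) (eqᵇ-sound P T P≟T))
                      (solve 2 (λ x c → 𝟙 :* (x :* c) := x :* (𝟙 :* c)) refl (X T) c)
  ... | false = solve 3 (λ x y c → 𝟘 :* (x :* c) := y :* (𝟘 :* c)) refl (X P) (X T) c

  -- Pointwise, the mass of Y is the mass of its pattern times weight(Y)², and the
  -- squared weights of the subsets with a given pattern sum to 1.
  compositionMass : ∀ k n g f μ → (∀ i → All Nondegenerate (μ i)) → All Nondegenerate (means k n g μ) →
    ∀ T → Σcube (total k n) (λ Y → ⟦ eqᵇ (blockPattern k n Y) T ⟧ * massNE (concatBlocks k n μ) (compose k n g f) Y)
          ≡ massNE (means k n g μ) f T
  compositionMass k n g f μ ndμ ndη T = begin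
    Σcube N (λ Y → ⟦ eqᵇ (patternOf Y) T ⟧ * massNE μh h Y)
      ≡⟨ ∑-cong (cube N) (λ Y → cong (⟦ eqᵇ (patternOf Y) T ⟧ *_) (mass-composition Y)) ⟩
    Σcube N (λ Y → ⟦ eqᵇ (patternOf Y) T ⟧ * (massNE η f (patternOf Y) * w Y ²))
      ≡⟨ ∑-cong (cube N) (λ Y → at-pattern (patternOf Y) T (massNE η f) (w Y ²)) ⟩
    Σcube N (λ Y → massNE η f T * (⟦ eqᵇ (patternOf Y) T ⟧ * w Y ²))
      ≡⟨ ∑-*ˡ (cube N) (massNE η f T) _ ⟩
    massNE η f T * Σcube N (λ Y → ⟦ eqᵇ (patternOf Y) T ⟧ * w Y ²)
      ≡⟨ cong (massNE η f T *_) (patternMass k n g μ ndμ ndη T) ⟩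
    massNE η f T * 1#
      ≡⟨ *-identityʳ _ ⟩
    massNE η f T ∎
    where
    N = total k n
    μh = concatBlocks k n μ
    h = compose k n g f
    η = means k n g μ
    patternOf = blockPattern k n
    w = weight k n g μ

    coeff-h : ∀ Y → coeff μh h Y ≡ coeff η f (patternOf Y) * w Y
    coeff-h = compositionCoeff k n g μ ndη (λ z → ± (f z))

    coeff-h-∅ : coeff μh h ∅ ≡ coeff η f ∅
    coeff-h-∅ = begin
      coeff μh h ∅                   ≡⟨ coeff-h ∅ ⟩
      coeff η f (patternOf ∅) * w ∅    ≡⟨ cong₂ (λ P c → coeff η f P * c) patternOf-∅ (weight-empty k n g μ ∅ (∅-empty N)) ⟩
      coeff η f ∅ * 1#               ≡⟨ *-identityʳ _ ⟩
      coeff η f ∅                    ∎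
      where
      patternOf-∅ : patternOf ∅ ≡ ∅
      patternOf-∅ = empty⇒∅ (patternOf ∅) (trans (nonempty-pattern k n ∅) (∅-empty N))

    mass-composition : ∀ Y → massNE μh h Y ≡ massNE η f (patternOf Y) * w Y ²
    mass-composition Y = begin
      (if nonempty Y then coeff μh h Y ² * (1# - coeff μh h ∅ ²) ⁻¹ else 0#)
        ≡⟨ cong (λ s → if s then coeff μh h Y ² * (1# - coeff μh h ∅ ²) ⁻¹ else 0#) (sym (nonempty-pattern k n Y)) ⟩
      (if nonempty (patternOf Y) then coeff μh h Y ² * (1# - coeff μh h ∅ ²) ⁻¹ else 0#)
        ≡⟨ cong₂ (λ c d → if nonempty (patternOf Y) then c ² * (1# - d ²) ⁻¹ else 0#) (coeff-h Y) coeff-h-∅ ⟩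
      (if nonempty (patternOf Y) then (coeff η f (patternOf Y) * w Y) ² * D else 0#)
        ≡⟨ scale (nonempty (patternOf Y)) ⟩
      massNE η f (patternOf Y) * w Y ² ∎
      where
      D = (1# - coeff η f ∅ ²) ⁻¹
      scale : ∀ s → (if s then (coeff η f (patternOf Y) * w Y) ² * D else 0#) ≡
                    (if s then coeff η f (patternOf Y) ² * D else 0#) * w Y ²
      scale true  = solve 3 (λ c v d → c :* v :* (c :* v) :* d := c :* c :* d :* (v :* v)) refl (coeff η f (patternOf Y)) (w Y) D
      scale false = sym (zeroˡ _)

claim3p2 : (R : RealField) →
  let open RealField R
      open Fourier R
  in
  (k : ℕ) (n : Fin k → ℕ)
  (g : (i : Fin k) → Vec Bool (n i) → Bool) (f : Vec Bool k → Bool)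
  (μ : (i : Fin k) → Vec Carrier (n i)) →
  let h   = compose k n g f
      μh  = concatBlocks k n μ
      η   = tabulate (λ i → E (μ i) (λ x → ± (g i x)))
  in
  (∀ i j → (- 1# < lookup (μ i) j) × (lookup (μ i) j < 1#)) →
  (∀ i → (- 1# < lookup η i) × (lookup η i < 1#)) →
  0# < Var μh h →
  0# < Var η f →
  (T : Vec Bool k) →
  sumL (map (λ Y → ⟦ eqᵇ (blockPattern k n Y) T ⟧ * massNE μh h Y) (cube (total k n)))
    ≡ massNE η f T
claim3p2 R k n g f μ μ-bounded η-bounded _ _ =
  compositionMass k n g f μ (λ i → lookup⁻ (λ j → nondegenerate (μ-bounded i j))) (lookup⁻ (λ i → nondegenerate (η-bounded i)))
  where open Development R
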